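{- Let $\mathbf B_1,\mathbf B_2\in\mathcal V$ and let $P$ be a $(\mathbf B_1\times\mathbf B_2)$-pendant. Suppose there exist $x,y\in B_1$ and $u,v\in B_2$ such that $(x,u),(y,u),(x,v)\in P|_0$ and $(y,v)\in P|_1$. Then $P$ is zipped.
   Context: Fix a positive integer $m$. Let $\mathcal V$ be the variety whose basic operations are a $2m$-ary symbol $f$ and $m$-ary symbols $g_1,g_2$, axiomatized exactly by idempotence of $f,g_1,g_2$ ($t(x,\dots,x)=x$) and the identities $f(x,\dots,x,y,x,\dots,x)=g_1(x,\dots,x,y,x,\dots,x)$ ($y$ in position $i$ on both sides, $i=1,\dots,m$) and $f(x,\dots,x,y,x,\dots,x)=g_2(x,\dots,x,y,x,\dots,x)$ ($y$ in position $m+i$ on the left and $i$ on the right, $i=1,\dots,m$). Let $\mathbf A$ be the $\mathcal V$-free algebra generated by two elements $0,1$. $R_\omega\le\mathbf A^\omega$ is the subuniverse generated by all $\omega$-sequences having $1$ in exactly one coordinate and $0$ in all others. For $\mathbf B\in\mathcal V$, a $\mathbf B$-pendant is a subuniverse $P\le\mathbf B\times\mathbf A^\omega$ invariant under all permutations of the $\omega$ coordinates of $\mathbf A^\omega$. Set $P|_0=\{b\in B:(b,(0,0,\dots))\in P\}$ and $P|_1=\{b\in B:\exists \bar r\in R_\omega,\ (b,\bar r)\in P\}$. The pendant $P$ is zipped if $P|_0\cap P|_1\neq\emptyset$. -}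

module Defs where

open import Level using (Level; _⊔_) renaming (suc to lsuc)
open import Data.Nat using (ℕ; _+_; _≡ᵇ_)
open import Data.Fin using (Fin; zero; suc; _↑ˡ_; _↑ʳ_; _≟_)
open import Data.Bool using (if_then_else_)
open import Data.Product using (_×_; _,_; proj₁; proj₂; Σ; ∃)
open import Relation.Nullary using (does)
open import Relation.Unary using (Pred)
open import Relation.Binary using (Rel; IsEquivalence)
open import Function using (_∘_)
open import Function.Bundles using (_↔_; Inverse)
open import Data.Bool using (true; false)
open import Relation.Binary.PropositionalEquality using (_≡_; refl) renaming (sym to sym')

upd : ∀ {a} {A : Set a} {n : ℕ} → Fin n → A → A → Fin n → A
upd i x y j = if does (j ≟ i) then y else x

-- The variety 𝒱 (parametrised by m): f is 2m-ary (arity m + m),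
-- g₁, g₂ are m-ary.  Algebras are setoid-based (carrier with an
-- equivalence relation that is a congruence for the operations).

record VAlg (m : ℕ) (a ℓ : Level) : Set (lsuc (a ⊔ ℓ)) where
  field
    Carrier : Set a
    _≈_     : Rel Carrier ℓ
    isEquiv : IsEquivalence _≈_
    fᴬ      : (Fin (m + m) → Carrier) → Carrier
    g₁ᴬ     : (Fin m → Carrier) → Carrier
    g₂ᴬ     : (Fin m → Carrier) → Carrier
    f-cong  : ∀ {xs ys} → (∀ j → xs j ≈ ys j) → fᴬ xs ≈ fᴬ ys
    g₁-cong : ∀ {xs ys} → (∀ j → xs j ≈ ys j) → g₁ᴬ xs ≈ g₁ᴬ ys
    g₂-cong : ∀ {xs ys} → (∀ j → xs j ≈ ys j) → g₂ᴬ xs ≈ g₂ᴬ ys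
    f-idem  : ∀ x → fᴬ (λ _ → x) ≈ x
    g₁-idem : ∀ x → g₁ᴬ (λ _ → x) ≈ x
    g₂-idem : ∀ x → g₂ᴬ (λ _ → x) ≈ x
    fg₁     : ∀ (i : Fin m) x y → fᴬ (upd (i ↑ˡ m) x y) ≈ g₁ᴬ (upd i x y)
    fg₂     : ∀ (i : Fin m) x y → fᴬ (upd (m ↑ʳ i) x y) ≈ g₂ᴬ (upd i x y)

upd-map : ∀ {a b} {A : Set a} {B : Set b} {n : ℕ} (h : A → B) (i : Fin n) (x y : A)
          (j : Fin n) → h (upd i x y j) ≡ upd i (h x) (h y) j
upd-map h i x y j with does (j ≟ i)
... | true  = refl
... | false = refl

_×ᴬ_ : ∀ {m a₁ ℓ₁ a₂ ℓ₂} → VAlg m a₁ ℓ₁ → VAlg m a₂ ℓ₂ → VAlg m (a₁ ⊔ a₂) (ℓ₁ ⊔ ℓ₂)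
_×ᴬ_ {m} B₁ B₂ = record
  { Carrier = B₁.Carrier × B₂.Carrier
  ; _≈_     = λ p q → (proj₁ p B₁.≈ proj₁ q) × (proj₂ p B₂.≈ proj₂ q)
  ; isEquiv = record
      { refl  = E₁.refl , E₂.refl
      ; sym   = λ (p , q) → E₁.sym p , E₂.sym q
      ; trans = λ (p , q) (p' , q') → E₁.trans p p' , E₂.trans q q' }
  ; fᴬ      = λ xs → B₁.fᴬ (proj₁ ∘ xs) , B₂.fᴬ (proj₂ ∘ xs)
  ; g₁ᴬ     = λ xs → B₁.g₁ᴬ (proj₁ ∘ xs) , B₂.g₁ᴬ (proj₂ ∘ xs)
  ; g₂ᴬ     = λ xs → B₁.g₂ᴬ (proj₁ ∘ xs) , B₂.g₂ᴬ (proj₂ ∘ xs)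
  ; f-cong  = λ e → B₁.f-cong (proj₁ ∘ e) , B₂.f-cong (proj₂ ∘ e)
  ; g₁-cong = λ e → B₁.g₁-cong (proj₁ ∘ e) , B₂.g₁-cong (proj₂ ∘ e)
  ; g₂-cong = λ e → B₁.g₂-cong (proj₁ ∘ e) , B₂.g₂-cong (proj₂ ∘ e)
  ; f-idem  = λ x → B₁.f-idem (proj₁ x) , B₂.f-idem (proj₂ x)
  ; g₁-idem = λ x → B₁.g₁-idem (proj₁ x) , B₂.g₁-idem (proj₂ x)
  ; g₂-idem = λ x → B₁.g₂-idem (proj₁ x) , B₂.g₂-idem (proj₂ x)
  ; fg₁     = λ i x y → fg₁' B₁ proj₁ i x y , fg₁' B₂ proj₂ i x y
  ; fg₂     = λ i x y → fg₂' B₁ proj₁ i x y , fg₂' B₂ proj₂ i x y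
  }
  where
  module B₁ = VAlg B₁
  module B₂ = VAlg B₂
  module E₁ = IsEquivalence B₁.isEquiv
  module E₂ = IsEquivalence B₂.isEquiv
  P = B₁.Carrier × B₂.Carrier
  fg₁' : ∀ {a ℓ} (C : VAlg m a ℓ) (h : P → VAlg.Carrier C) i x y →
         VAlg._≈_ C (VAlg.fᴬ C (h ∘ upd (i ↑ˡ m) x y)) (VAlg.g₁ᴬ C (h ∘ upd i x y))
  fg₁' C h i x y = trans (f-cong (λ j → reflexive (upd-map h (i ↑ˡ m) x y j)))
                  (trans (fg₁ i (h x) (h y))
                  (g₁-cong (λ j → reflexive (sym' (upd-map h i x y j)))))
    where open VAlg C
          open IsEquivalence isEquiv
  fg₂' : ∀ {a ℓ} (C : VAlg m a ℓ) (h : P → VAlg.Carrier C) i x y →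
         VAlg._≈_ C (VAlg.fᴬ C (h ∘ upd (m ↑ʳ i) x y)) (VAlg.g₂ᴬ C (h ∘ upd i x y))
  fg₂' C h i x y = trans (f-cong (λ j → reflexive (upd-map h (m ↑ʳ i) x y j)))
                  (trans (fg₂ i (h x) (h y))
                  (g₂-cong (λ j → reflexive (sym' (upd-map h i x y j)))))
    where open VAlg C
          open IsEquivalence isEquiv

-- The 𝒱-free algebra 𝐀 on two generators 0, 1: terms over Fin 2
-- modulo derivability from the axioms of 𝒱 (equational logic).

data Term (m : ℕ) (X : Set) : Set where
  var : X → Term m X
  f   : (Fin (m + m) → Term m X) → Term m X
  g₁  : (Fin m → Term m X) → Term m X
  g₂  : (Fin m → Term m X) → Term m X

data _⊢_≈_ (m : ℕ) {X : Set} : Term m X → Term m X → Set where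
  ≈refl   : ∀ {s} → m ⊢ s ≈ s
  ≈sym    : ∀ {s t} → m ⊢ s ≈ t → m ⊢ t ≈ s
  ≈trans  : ∀ {s t u} → m ⊢ s ≈ t → m ⊢ t ≈ u → m ⊢ s ≈ u
  f-cong  : ∀ {ss ts} → (∀ j → m ⊢ ss j ≈ ts j) → m ⊢ f ss ≈ f ts
  g₁-cong : ∀ {ss ts} → (∀ j → m ⊢ ss j ≈ ts j) → m ⊢ g₁ ss ≈ g₁ ts
  g₂-cong : ∀ {ss ts} → (∀ j → m ⊢ ss j ≈ ts j) → m ⊢ g₂ ss ≈ g₂ ts
  f-idem  : ∀ s → m ⊢ f (λ _ → s) ≈ s
  g₁-idem : ∀ s → m ⊢ g₁ (λ _ → s) ≈ s
  g₂-idem : ∀ s → m ⊢ g₂ (λ _ → s) ≈ s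
  fg₁     : ∀ (i : Fin m) s t → m ⊢ f (upd (i ↑ˡ m) s t) ≈ g₁ (upd i s t)
  fg₂     : ∀ (i : Fin m) s t → m ⊢ f (upd (m ↑ʳ i) s t) ≈ g₂ (upd i s t)

A : ℕ → Set
A m = Term m (Fin 2)

𝟘 𝟙 : ∀ {m} → A m
𝟘 = var zero
𝟙 = var (suc zero)

Aω : ℕ → Set
Aω m = ℕ → A m

_≈ω_ : ∀ {m} → Aω m → Aω m → Set
_≈ω_ {m} r s = ∀ n → m ⊢ r n ≈ s n

𝟘ω : ∀ {m} → Aω m
𝟘ω = λ _ → 𝟘

e : ∀ {m} → ℕ → Aω m
e i n = if i ≡ᵇ n then 𝟙 else 𝟘

-- R_ω : subuniverse of 𝐀^ω generated by the e i
-- (as a subset of the quotient, hence closed under ≈ω).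
data Rω (m : ℕ) : Aω m → Set where
  gen   : ∀ i → Rω m (e i)
  f-cl  : ∀ (rs : Fin (m + m) → Aω m) → (∀ j → Rω m (rs j)) → Rω m (λ n → f (λ j → rs j n))
  g₁-cl : ∀ (rs : Fin m → Aω m) → (∀ j → Rω m (rs j)) → Rω m (λ n → g₁ (λ j → rs j n))
  g₂-cl : ∀ (rs : Fin m → Aω m) → (∀ j → Rω m (rs j)) → Rω m (λ n → g₂ (λ j → rs j n))
  resp  : ∀ {r s} → Rω m r → r ≈ω s → Rω m s

module _ {m a ℓ} (B : VAlg m a ℓ) where
  open VAlg B

  -- P is a subuniverse of 𝐁 × 𝐀^ω (a subset of the quotient, so
  -- closed under the equality of 𝐁 × 𝐀^ω).
  record IsSubuniverse {p} (P : Pred (Carrier × Aω m) p) : Set (a ⊔ ℓ ⊔ p) where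
    field
      resp-≈ : ∀ {b b' r r'} → P (b , r) → b ≈ b' → r ≈ω r' → P (b' , r')
      sf-cl  : ∀ (xs : Fin (m + m) → Carrier × Aω m) → (∀ j → P (xs j)) →
              P (fᴬ (proj₁ ∘ xs) , λ n → f (λ j → proj₂ (xs j) n))
      sg₁-cl : ∀ (xs : Fin m → Carrier × Aω m) → (∀ j → P (xs j)) →
              P (g₁ᴬ (proj₁ ∘ xs) , λ n → g₁ (λ j → proj₂ (xs j) n))
      sg₂-cl : ∀ (xs : Fin m → Carrier × Aω m) → (∀ j → P (xs j)) →
              P (g₂ᴬ (proj₁ ∘ xs) , λ n → g₂ (λ j → proj₂ (xs j) n))

  record IsPendant {p} (P : Pred (Carrier × Aω m) p) : Set (a ⊔ ℓ ⊔ p) where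
    field
      subuniverse : IsSubuniverse P
      perm-inv    : ∀ (σ : ℕ ↔ ℕ) b r → P (b , r) → P (b , r ∘ Inverse.to σ)

  _∣₀ : ∀ {p} → Pred (Carrier × Aω m) p → Pred Carrier p
  (P ∣₀) b = P (b , 𝟘ω)

  _∣₁ : ∀ {p} → Pred (Carrier × Aω m) p → Pred Carrier p
  (P ∣₁) b = ∃ λ r → Rω m r × P (b , r)

  Zipped : ∀ {p} → Pred (Carrier × Aω m) p → Set (a ⊔ p)
  Zipped P = ∃ λ b → (P ∣₀) b × (P ∣₁) b

-- Write b ⋆ c for f(b,…,b,c,…,c).  P|₀ is closed under ⋆, and P|₁ absorbs P|₀ from
-- both sides: b ∈ P|₁ and c ∈ P|₀ give b ⋆ c ∈ P|₁ and c ⋆ b ∈ P|₁.  For b ⋆ c, the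
-- witness r ∈ R_ω of b has finite support, so permutations of ω yield m copies of r
-- with pairwise disjoint supports; placing them in the first half of f and 0 in the
-- second, each coordinate becomes f(0,…,0,t,0,…,0) = g₁(0,…,t,…,0), so the resulting
-- sequence is g₁ applied to the copies and stays in R_ω (for c ⋆ b use g₂).  Hence
-- ((x,v) ⋆ (y,u)) ⋆ ((x,v) ⋆ (x,u)) ∈ P|₀ and ((x,v) ⋆ (y,v)) ⋆ (x,u) ∈ P|₁, and by
-- idempotence of ⋆ both elements equal ((x ⋆ y) ⋆ x , v ⋆ u).

module Submission where

open import Defs
open import Level using (Level)
open import Data.Nat using (ℕ; _≤_)
open import Data.Product using (_×_; _,_)
open import Relation.Unary using (Pred)

open import Level using (0ℓ)
open import Data.Bool using (if_then_else_)
open import Data.Nat using (zero; suc; _+_; _*_; _<_; _⊔_; _/_; _%_; NonZero)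
open import Data.Nat.Properties using (_≟_; _<?_; ≤-trans; <⇒≤; <⇒≢; ≮⇒≥; m≤m⊔n; m≤n⊔m)
open import Data.Nat.Divisibility using (n∣m*n)
open import Data.Nat.DivMod
  using (m≡m%n+[m/n]*n; m%n<n; [m+kn]%n≡m%n; m<n⇒m%n≡m; m<n⇒m/n≡0; m*n/n≡m; +-distrib-/-∣ʳ)
open import Data.Fin as Fin using (Fin; toℕ; _↑ˡ_; _↑ʳ_; splitAt; join)
open import Data.Fin.Properties
  using (any?; toℕ-injective; ↑ˡ-injective; ↑ʳ-injective; splitAt-↑ˡ; splitAt-↑ʳ; join-splitAt)
open import Data.Product using (proj₁; proj₂; ∃; Σ)
open import Data.Sum using (_⊎_; inj₁; inj₂)
open import Data.Vec.Functional using (_++_)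
open import Data.Vec.Functional.Properties using (lookup-++ˡ; lookup-++ʳ)
open import Data.Vec.Functional.Relation.Binary.Pointwise using (Pointwise)
import Data.Vec.Functional.Relation.Binary.Pointwise.Properties as Pointwise
open import Data.Vec.Functional.Relation.Unary.All using (All)
import Data.Vec.Functional.Relation.Unary.All.Properties as All
open import Function using (_∘_; const)
open import Function.Bundles using (_↔_; Inverse; mk↔ₛ′)
open import Function.Definitions using (Injective)
open import Relation.Binary using (Setoid; IsEquivalence; REL)
open import Relation.Binary.PropositionalEquality
  using (_≡_; _≢_; refl; sym; trans; cong; cong₂; subst; module ≡-Reasoning)
open import Relation.Nullary using (¬_; yes; no; contradiction)
open import Relation.Nullary.Decidable using (dec-true; dec-false)
import Relation.Binary.Reasoning.Setoid as SetoidReasoning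
open import Relation.Unary using (Decidable)

Eventually : ∀ {p} → (ℕ → Set p) → Set p
Eventually Q = ∃ λ N → ∀ n → N ≤ n → Q n

eventually-∀ : ∀ {p k} {Q : Fin k → ℕ → Set p} →
               (∀ j → Eventually (Q j)) → Eventually (λ n → ∀ j → Q j n)
eventually-∀ {k = zero}  _  = 0 , λ _ _ ()
eventually-∀ {k = suc k} ev with ev Fin.zero | eventually-∀ (ev ∘ Fin.suc)
... | N₀ , h₀ | N , h = N₀ ⊔ N , λ where
  n N₀⊔N≤n Fin.zero    → h₀ n (≤-trans (m≤m⊔n N₀ N) N₀⊔N≤n)
  n N₀⊔N≤n (Fin.suc j) → h n (≤-trans (m≤n⊔m N₀ N) N₀⊔N≤n) j

AllButAtMostOne : ∀ {k q} → Pred (Fin k) q → Set q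
AllButAtMostOne Q = (∀ i → Q i) ⊎ ∃ λ k → ∀ i → i ≢ k → Q i

allButAtMostOne : ∀ {k p q} {Bad : Pred (Fin k) p} {Q : Pred (Fin k) q} →
                  Decidable Bad → (∀ {i j} → Bad i → Bad j → i ≡ j) →
                  (∀ i → ¬ Bad i → Q i) → AllButAtMostOne Q
allButAtMostOne bad? unique good with any? bad?
... | yes (k , bad-k) = inj₂ (k , λ i i≢k → good i (λ bad-i → i≢k (unique bad-i bad-k)))
... | no none         = inj₁ (λ i → good i (λ bad-i → none (i , bad-i)))

module _ {a} {X : Set a} where

  upd-self : ∀ {n} (i : Fin n) (x y : X) → upd i x y i ≡ y
  upd-self i x y = cong (if_then y else x) (dec-true (i Fin.≟ i) refl)

  upd-other : ∀ {n} {i j : Fin n} (x y : X) → j ≢ i → upd i x y j ≡ x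
  upd-other {i = i} {j} x y j≢i = cong (if_then y else x) (dec-false (j Fin.≟ i) j≢i)

  upd-injective : ∀ {n k} (h : Fin n → Fin k) → Injective _≡_ _≡_ h →
                  ∀ i j (x y : X) → upd (h i) x y (h j) ≡ upd i x y j
  upd-injective h h-inj i j x y with j Fin.≟ i
  ... | yes refl = upd-self (h i) x y
  ... | no j≢i   = upd-other x y (j≢i ∘ h-inj)

↑ˡ≢↑ʳ : ∀ {m n} (i : Fin m) (j : Fin n) → i ↑ˡ n ≢ m ↑ʳ j
↑ˡ≢↑ʳ {m} {n} i j eq
  with () ← trans (sym (splitAt-↑ˡ m i n)) (trans (cong (splitAt m) eq) (splitAt-↑ʳ m n j))

data Side : Set where
  left right : Side

module _ {m : ℕ} where

  halves : ∀ {a} {X : Set a} → Side → (Fin m → X) → (Fin m → X) → Fin (m + m) → X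
  halves left  xs ys = xs ++ ys
  halves right xs ys = ys ++ xs

  inject : Side → Fin m → Fin (m + m)
  inject left  i = i ↑ˡ m
  inject right i = m ↑ʳ i

  halves-pointwise : ∀ {a b r} {X : Set a} {Y : Set b} (R : REL X Y r) s {xs ys xs′ ys′} →
                     Pointwise R xs xs′ → Pointwise R ys ys′ →
                     Pointwise R (halves s xs ys) (halves s xs′ ys′)
  halves-pointwise R left  xs~xs′ ys~ys′ = Pointwise.++⁺ R {m} {m} xs~xs′ ys~ys′
  halves-pointwise R right xs~xs′ ys~ys′ = Pointwise.++⁺ R {m} {m} ys~ys′ xs~xs′

  halves-all : ∀ {a q} {X : Set a} {Q : Pred X q} s {xs ys} →
               All Q xs → All Q ys → All Q (halves s xs ys)
  halves-all {Q = Q} left  {xs} {ys} Qxs Qys = All.++⁺ Q {xs = xs} {ys} Qxs Qys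
  halves-all {Q = Q} right {xs} {ys} Qxs Qys = All.++⁺ Q {xs = ys} {xs} Qys Qxs

  halves-map : ∀ {a b} {X : Set a} {Y : Set b} (h : X → Y) s xs ys →
               Pointwise _≡_ (h ∘ halves s xs ys) (halves s (h ∘ xs) (h ∘ ys))
  halves-map h s xs ys = halves-pointwise (λ x y → h x ≡ y) s (λ _ → refl) (λ _ → refl)

  upd-inject : ∀ {a} {X : Set a} s i (x y : X) →
               Pointwise _≡_ (upd (inject s i) x y) (halves s (upd i x y) (const x))
  upd-inject s i x y j =
    subst (λ j → upd (inject s i) x y j ≡ halves s (upd i x y) (const x) j)
          (join-splitAt m m j) (atJoin s (splitAt m j))
    where
    atJoin : ∀ side t → upd (inject side i) x y (join m m t) ≡ halves side (upd i x y) (const x) (join m m t)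
    atJoin left (inj₁ k) = trans (upd-injective (_↑ˡ m) (↑ˡ-injective m _ _) i k x y)
                                 (sym (lookup-++ˡ {m = m} (upd i x y) (const x) k))
    atJoin left (inj₂ k) = trans (upd-other x y (↑ˡ≢↑ʳ i k ∘ sym))
                                 (sym (lookup-++ʳ {m = m} (upd i x y) (const x) k))
    atJoin right (inj₁ k) = trans (upd-other x y (↑ˡ≢↑ʳ k i))
                                  (sym (lookup-++ˡ {m = m} (const x) (upd i x y) k))
    atJoin right (inj₂ k) = trans (upd-injective (m ↑ʳ_) (↑ʳ-injective m _ _) i k x y)
                                  (sym (lookup-++ʳ {m = m} (const x) (upd i x y) k))

termSetoid : ℕ → Set → Setoid 0ℓ 0ℓ
termSetoid m X = record
  { Carrier       = Term m X
  ; _≈_           = m ⊢_≈_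
  ; isEquivalence = record { refl = ≈refl ; sym = ≈sym ; trans = ≈trans }
  }

module _ {m : ℕ} {X : Set} where

  ≡⇒≈ : {s t : Term m X} → s ≡ t → m ⊢ s ≈ t
  ≡⇒≈ refl = ≈refl

  g : Side → (Fin m → Term m X) → Term m X
  g left  = g₁
  g right = g₂

  g-cong : ∀ s {ss ts} → Pointwise (m ⊢_≈_) ss ts → m ⊢ g s ss ≈ g s ts
  g-cong left  = g₁-cong
  g-cong right = g₂-cong

  g-idem : ∀ s t → m ⊢ g s (const t) ≈ t
  g-idem left  = g₁-idem
  g-idem right = g₂-idem

  f-upd-inject : ∀ s i x y → m ⊢ f (upd (inject s i) x y) ≈ g s (upd i x y)
  f-upd-inject left  = fg₁
  f-upd-inject right = fg₂

  f-halves-g : ∀ s {ts : Fin m → Term m X} {z} → AllButAtMostOne (λ i → m ⊢ ts i ≈ z) →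
               m ⊢ f (halves s ts (const z)) ≈ g s ts
  f-halves-g s {ts} {z} (inj₁ ts≈z) = begin
    f (halves s ts (const z)) ≈⟨ f-cong (halves-all {Q = λ t → m ⊢ t ≈ z} s ts≈z (λ _ → ≈refl)) ⟩
    f (const z)               ≈⟨ f-idem z ⟩
    z                         ≈⟨ g-idem s z ⟨
    g s (const z)             ≈⟨ g-cong s ts≈z ⟨
    g s ts                    ∎
    where open SetoidReasoning (termSetoid m X)
  f-halves-g s {ts} {z} (inj₂ (k , ts≈z)) = begin
    f (halves s ts (const z))     ≈⟨ f-cong (halves-pointwise (m ⊢_≈_) s ts≈t (λ _ → ≈refl)) ⟩
    f (halves s t (const z))      ≈⟨ f-cong (≡⇒≈ ∘ upd-inject s k z (ts k)) ⟨
    f (upd (inject s k) z (ts k)) ≈⟨ f-upd-inject s k z (ts k) ⟩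
    g s t                         ≈⟨ g-cong s ts≈t ⟨
    g s ts                        ∎
    where
    open SetoidReasoning (termSetoid m X)
    t : Fin m → Term m X
    t = upd k z (ts k)
    ts≈t : Pointwise (m ⊢_≈_) ts t
    ts≈t i with i Fin.≟ k
    ... | yes refl = ≈refl
    ... | no i≢k   = ts≈z i i≢k

FinitelySupported : ∀ {m} → Aω m → Set
FinitelySupported {m} r = Eventually (λ n → m ⊢ r n ≈ 𝟘)

e-self : ∀ {m} i → e {m} i i ≡ 𝟙
e-self i = cong (if_then 𝟙 else 𝟘) (dec-true (i ≟ i) refl)

e-other : ∀ {m i n} → i ≢ n → e {m} i n ≡ 𝟘
e-other {i = i} {n} i≢n = cong (if_then 𝟙 else 𝟘) (dec-false (i ≟ n) i≢n)

pointwise-finitelySupported :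
  ∀ {m k} (op : (Fin k → A m) → A m) →
  (∀ {ss ts} → Pointwise (m ⊢_≈_) ss ts → m ⊢ op ss ≈ op ts) → m ⊢ op (const 𝟘) ≈ 𝟘 →
  {rs : Fin k → Aω m} → All FinitelySupported rs → FinitelySupported (λ n → op (λ j → rs j n))
pointwise-finitelySupported op op-cong op-𝟘 rs-fin with eventually-∀ rs-fin
... | N , rs≈𝟘 = N , λ n N≤n → ≈trans (op-cong (rs≈𝟘 n N≤n)) op-𝟘

Rω-finitelySupported : ∀ {m r} → Rω m r → FinitelySupported r
Rω-finitelySupported (gen i) = suc i , λ n i<n → ≡⇒≈ (e-other (<⇒≢ i<n))
Rω-finitelySupported (f-cl rs rs∈R) =
  pointwise-finitelySupported f f-cong (f-idem 𝟘) (λ j → Rω-finitelySupported (rs∈R j))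
Rω-finitelySupported (g₁-cl rs rs∈R) =
  pointwise-finitelySupported g₁ g₁-cong (g₁-idem 𝟘) (λ j → Rω-finitelySupported (rs∈R j))
Rω-finitelySupported (g₂-cl rs rs∈R) =
  pointwise-finitelySupported g₂ g₂-cong (g₂-idem 𝟘) (λ j → Rω-finitelySupported (rs∈R j))
Rω-finitelySupported (resp r∈R r≈s) with Rω-finitelySupported r∈R
... | N , r≈𝟘 = N , λ n N≤n → ≈trans (≈sym (r≈s n)) (r≈𝟘 n N≤n)

module _ {m : ℕ} (σ : ℕ ↔ ℕ) where
  open Inverse σ using (to; from; strictlyInverseˡ; strictlyInverseʳ)

  e-from : ∀ i n → e {m} (from i) n ≡ e i (to n)
  e-from i n with from i ≟ n
  ... | yes refl = trans (e-self (from i)) (sym (trans (cong (e i) (strictlyInverseˡ i)) (e-self i)))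
  ... | no i′≢n  = trans (e-other i′≢n) (sym (e-other (λ i≡n′ → i′≢n (trans (cong from i≡n′) (strictlyInverseʳ n)))))

  Rω-permute : ∀ {r} → Rω m r → Rω m (r ∘ to)
  Rω-permute (gen i)         = resp (gen (from i)) (≡⇒≈ ∘ e-from i)
  Rω-permute (f-cl _ rs∈R)   = f-cl _ (λ j → Rω-permute (rs∈R j))
  Rω-permute (g₁-cl _ rs∈R)  = g₁-cl _ (λ j → Rω-permute (rs∈R j))
  Rω-permute (g₂-cl _ rs∈R)  = g₂-cl _ (λ j → Rω-permute (rs∈R j))
  Rω-permute (resp r∈R r≈s)  = resp (Rω-permute r∈R) (r≈s ∘ to)

Rω-g : ∀ {m} s {rs : Fin m → Aω m} → All (Rω m) rs → Rω m (λ n → g s (λ j → rs j n))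
Rω-g left  = g₁-cl _
Rω-g right = g₂-cl _

swap₀ : ℕ → ℕ → ℕ
swap₀ i zero = i
swap₀ i (suc q) with suc q ≟ i
... | yes _ = zero
... | no _  = suc q

swap₀-involutive : ∀ i q → swap₀ i (swap₀ i q) ≡ q
swap₀-involutive zero    zero = refl
swap₀-involutive (suc i) zero with suc i ≟ suc i
... | yes _  = refl
... | no i≢i = contradiction refl i≢i
swap₀-involutive i (suc q) with suc q ≟ i
... | yes q≡i = sym q≡i
... | no q≢i with suc q ≟ i
...   | yes q≡i = contradiction q≡i q≢i
...   | no _    = refl

module _ (N : ℕ) .{{_ : NonZero N}} where
  open ≡-Reasoning

  [r+q*N]/N≡q : ∀ {ρ} q → ρ < N → (ρ + q * N) / N ≡ q
  [r+q*N]/N≡q {ρ} q ρ<N = begin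
    (ρ + q * N) / N   ≡⟨ +-distrib-/-∣ʳ ρ (n∣m*n q) ⟩
    ρ / N + q * N / N ≡⟨ cong₂ _+_ (m<n⇒m/n≡0 ρ<N) (m*n/n≡m q N) ⟩
    q                 ∎

  [r+q*N]%N≡r : ∀ {ρ} q → ρ < N → (ρ + q * N) % N ≡ ρ
  [r+q*N]%N≡r {ρ} q ρ<N = trans ([m+kn]%n≡m%n ρ q N) (m<n⇒m%n≡m ρ<N)

  blockSwap : ℕ → ℕ → ℕ
  blockSwap i n = n % N + swap₀ i (n / N) * N

  blockSwap-involutive : ∀ i n → blockSwap i (blockSwap i n) ≡ n
  blockSwap-involutive i n = begin
    blockSwap i n % N + swap₀ i (blockSwap i n / N) * N
      ≡⟨ cong₂ (λ ρ q → ρ + swap₀ i q * N) ([r+q*N]%N≡r q′ (m%n<n n N)) ([r+q*N]/N≡q q′ (m%n<n n N)) ⟩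
    n % N + swap₀ i q′ * N
      ≡⟨ cong (λ q → n % N + q * N) (swap₀-involutive i (n / N)) ⟩
    n % N + n / N * N
      ≡⟨ m≡m%n+[m/n]*n n N ⟨
    n ∎
    where q′ = swap₀ i (n / N)

  blockSwap-< : ∀ i n → blockSwap i n < N → n / N ≡ i
  blockSwap-< i n σn<N = begin
    n / N                     ≡⟨ swap₀-involutive i (n / N) ⟨
    swap₀ i (swap₀ i (n / N)) ≡⟨ cong (swap₀ i) q′≡0 ⟩
    swap₀ i 0                 ∎
    where
    q′≡0 : swap₀ i (n / N) ≡ 0
    q′≡0 = trans (sym ([r+q*N]/N≡q (swap₀ i (n / N)) (m%n<n n N))) (m<n⇒m/n≡0 σn<N)

  blockSwap↔ : ℕ → ℕ ↔ ℕ
  blockSwap↔ i = mk↔ₛ′ (blockSwap i) (blockSwap i) (blockSwap-involutive i) (blockSwap-involutive i)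

-- σ i exchanges the blocks [0, N) and [i N, (i+1) N); once N bounds the support of r,
-- the copies r ∘ σ i are supported on the pairwise disjoint blocks.
DisjointCopies : ∀ {m} → ℕ → Aω m → Set
DisjointCopies {m} k r =
  Σ (Fin k → ℕ ↔ ℕ) λ σ → ∀ n → AllButAtMostOne (λ i → m ⊢ r (Inverse.to (σ i) n) ≈ 𝟘)

disjointCopies : ∀ {m k} {r : Aω m} → FinitelySupported r → DisjointCopies k r
disjointCopies {m} {k} {r} (S , r≈𝟘) = σ , λ n →
  allButAtMostOne (λ i → blockSwap N (toℕ i) n <? N)
    (λ σᵢn<N σⱼn<N → toℕ-injective (trans (sym (blockSwap-< N _ n σᵢn<N)) (blockSwap-< N _ n σⱼn<N)))
    (λ i σᵢn≮N → r≈𝟘 _ (<⇒≤ (≮⇒≥ σᵢn≮N)))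
  where
  N : ℕ
  N = suc S
  σ : Fin k → ℕ ↔ ℕ
  σ i = blockSwap↔ N (toℕ i)

module Binary {m a ℓ} (B : VAlg m a ℓ) where
  open VAlg B using (Carrier; _≈_; isEquiv; fᴬ) renaming (f-cong to fᴬ-cong; f-idem to fᴬ-idem)
  open IsEquivalence isEquiv using () renaming (refl to ≈-refl; trans to ≈-trans)

  setoid : Setoid a ℓ
  setoid = record { isEquivalence = isEquiv }

  infixl 25 _⋆_
  opaque
    _⋆_ : Carrier → Carrier → Carrier
    x ⋆ y = fᴬ (halves {m = m} left (const x) (const y))

  opaque
    unfolding _⋆_

    ⋆-cong : ∀ {x x′ y y′} → x ≈ x′ → y ≈ y′ → x ⋆ y ≈ x′ ⋆ y′
    ⋆-cong x≈x′ y≈y′ = fᴬ-cong (halves-pointwise {m = m} _≈_ left (const x≈x′) (const y≈y′))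

    ⋆-idem : ∀ x → x ⋆ x ≈ x
    ⋆-idem x = ≈-trans (fᴬ-cong (halves-all {m = m} {Q = _≈ x} left (λ _ → ≈-refl) (λ _ → ≈-refl))) (fᴬ-idem x)

module _ {m a₁ ℓ₁ a₂ ℓ₂} (B₁ : VAlg m a₁ ℓ₁) (B₂ : VAlg m a₂ ℓ₂) where
  private
    module B₁ = VAlg B₁
    module B₂ = VAlg B₂
    module E₁ = IsEquivalence B₁.isEquiv
    module E₂ = IsEquivalence B₂.isEquiv
  open Binary B₁ using () renaming (_⋆_ to _⋆₁_; ⋆-cong to ⋆₁-cong; ⋆-idem to ⋆₁-idem)
  open Binary B₂ using () renaming (_⋆_ to _⋆₂_; ⋆-cong to ⋆₂-cong; ⋆-idem to ⋆₂-idem)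
  open Binary (B₁ ×ᴬ B₂)
  open VAlg (B₁ ×ᴬ B₂) using (_≈_)

  opaque
    unfolding _⋆_
    ⋆-pair : ∀ x y u v → (x , u) ⋆ (y , v) ≈ (x ⋆₁ y , u ⋆₂ v)
    ⋆-pair x y u v = B₁.f-cong (E₁.reflexive ∘ halves-map {m = m} proj₁ left (const (x , u)) (const (y , v)))
                   , B₂.f-cong (E₂.reflexive ∘ halves-map {m = m} proj₂ left (const (x , u)) (const (y , v)))

  ⋆-zip : ∀ x y u v → ((x , v) ⋆ (y , v)) ⋆ (x , u) ≈ ((x , v) ⋆ (y , u)) ⋆ ((x , v) ⋆ (x , u))
  ⋆-zip x y u v = begin
    ((x , v) ⋆ (y , v)) ⋆ (x , u)                ≈⟨ ⋆-cong (⋆-pair x y v v) (E₁.refl , E₂.refl) ⟩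
    (x ⋆₁ y , v ⋆₂ v) ⋆ (x , u)                  ≈⟨ ⋆-pair (x ⋆₁ y) x (v ⋆₂ v) u ⟩
    ((x ⋆₁ y) ⋆₁ x , (v ⋆₂ v) ⋆₂ u)              ≈⟨ ⋆₁-cong E₁.refl (E₁.sym (⋆₁-idem x))
                                                  , E₂.trans (⋆₂-cong (⋆₂-idem v) E₂.refl) (E₂.sym (⋆₂-idem (v ⋆₂ u))) ⟩
    ((x ⋆₁ y) ⋆₁ (x ⋆₁ x) , (v ⋆₂ u) ⋆₂ (v ⋆₂ u)) ≈⟨ ⋆-pair (x ⋆₁ y) (x ⋆₁ x) (v ⋆₂ u) (v ⋆₂ u) ⟨
    (x ⋆₁ y , v ⋆₂ u) ⋆ (x ⋆₁ x , v ⋆₂ u)        ≈⟨ ⋆-cong (⋆-pair x y v u) (⋆-pair x x v u) ⟨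
    ((x , v) ⋆ (y , u)) ⋆ ((x , v) ⋆ (x , u))    ∎
    where open SetoidReasoning setoid

module PendantClosure {m a ℓ p} (B : VAlg m a ℓ) {P : Pred (VAlg.Carrier B × Aω m) p}
                      (pend : IsPendant B P) where
  open VAlg B using (Carrier; _≈_; isEquiv; fᴬ) renaming (f-cong to fᴬ-cong)
  open IsEquivalence isEquiv using (reflexive) renaming (refl to ≈-refl)
  open IsPendant pend
  open IsSubuniverse subuniverse
  open Binary B

  P₀ P₁ : Pred Carrier p
  P₀ = _∣₀ B P
  P₁ = _∣₁ B P

  P₀-fᴬ : ∀ {bs} → All P₀ bs → P₀ (fᴬ bs)
  P₀-fᴬ {bs} bs∈P₀ = resp-≈ (sf-cl (λ j → bs j , 𝟘ω) bs∈P₀) ≈-refl (λ _ → f-idem 𝟘)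

  P₁-resp : ∀ {b b′} → b ≈ b′ → P₁ b → P₁ b′
  P₁-resp b≈b′ (r , r∈R , Pbr) = r , r∈R , resp-≈ Pbr b≈b′ (λ _ → ≈refl)

  P₁-absorb : ∀ s {b c} → P₁ b → P₀ c → P₁ (fᴬ (halves {m = m} s (const b) (const c)))
  P₁-absorb s {b} {c} (r , r∈R , Pbr) Pc = t , t∈R , resp-≈ (sf-cl xs xs∈P) carrier≈ sequence≈
    where
    copies : DisjointCopies m r
    copies = disjointCopies (Rω-finitelySupported r∈R)
    σ : Fin m → ℕ ↔ ℕ
    σ = proj₁ copies
    rσ : Fin m → Aω m
    rσ i = r ∘ Inverse.to (σ i)
    xs : Fin (m + m) → Carrier × Aω m
    xs = halves s (λ i → b , rσ i) (const (c , 𝟘ω))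
    xs∈P : All P xs
    xs∈P = halves-all {Q = P} s (λ i → perm-inv (σ i) b r Pbr) (const Pc)
    t : Aω m
    t n = g s (λ i → rσ i n)
    t∈R : Rω m t
    t∈R = Rω-g s (λ i → Rω-permute (σ i) r∈R)
    carrier≈ : fᴬ (proj₁ ∘ xs) ≈ fᴬ (halves {m = m} s (const b) (const c))
    carrier≈ = fᴬ-cong (reflexive ∘ halves-map proj₁ s (λ i → b , rσ i) (const (c , 𝟘ω)))
    sequence≈ : ∀ n → m ⊢ f (λ j → proj₂ (xs j) n) ≈ t n
    sequence≈ n = ≈trans (f-cong (≡⇒≈ ∘ halves-map (λ x → proj₂ x n) s (λ i → b , rσ i) (const (c , 𝟘ω))))
                         (f-halves-g s (proj₂ copies n))

  opaque
    unfolding _⋆_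

    P₀-⋆ : ∀ {b c} → P₀ b → P₀ c → P₀ (b ⋆ c)
    P₀-⋆ b∈P₀ c∈P₀ = P₀-fᴬ (halves-all {m = m} {Q = P₀} left (const b∈P₀) (const c∈P₀))

    P₁-⋆ˡ : ∀ {b c} → P₁ b → P₀ c → P₁ (b ⋆ c)
    P₁-⋆ˡ = P₁-absorb left

    P₁-⋆ʳ : ∀ {b c} → P₀ c → P₁ b → P₁ (c ⋆ b)
    P₁-⋆ʳ c∈P₀ b∈P₁ = P₁-absorb right b∈P₁ c∈P₀

mainTheorem8 : ∀ {a₁ ℓ₁ a₂ ℓ₂ p : Level} (m : ℕ) → 1 ≤ m →
    (B₁ : VAlg m a₁ ℓ₁) (B₂ : VAlg m a₂ ℓ₂) →
    (P : Pred (VAlg.Carrier (B₁ ×ᴬ B₂) × Aω m) p) →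
    IsPendant (B₁ ×ᴬ B₂) P →
    (x y : VAlg.Carrier B₁) (u v : VAlg.Carrier B₂) →
    _∣₀ (B₁ ×ᴬ B₂) P (x , u) →
    _∣₀ (B₁ ×ᴬ B₂) P (y , u) →
    _∣₀ (B₁ ×ᴬ B₂) P (x , v) →
    _∣₁ (B₁ ×ᴬ B₂) P (y , v) →
    Zipped (B₁ ×ᴬ B₂) P
mainTheorem8 _ _ B₁ B₂ _ pend x y u v xu∈P₀ yu∈P₀ xv∈P₀ yv∈P₁ =
  _ , P₀-⋆ (P₀-⋆ xv∈P₀ yu∈P₀) (P₀-⋆ xv∈P₀ xu∈P₀)
    , P₁-resp (⋆-zip B₁ B₂ x y u v) (P₁-⋆ˡ (P₁-⋆ʳ xv∈P₀ yv∈P₁) xu∈P₀)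
  where open PendantClosure (B₁ ×ᴬ B₂) pend
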